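{- Let $n \geq 3$ be an integer and let $H_n$ be the graph obtained from the wheel $W_n$ by deleting one spoke. Then $H_n$ is super edge-magic if and only if $n \leq 4$.
   Context: All graphs are finite and simple. For a graph $G$ with $p=|V(G)|$ vertices and $q=|E(G)|$ edges, a super edge-magic labeling is a bijection $f: V(G)\cup E(G)\to\{1,2,\ldots,p+q\}$ with $f(V(G))=\{1,\ldots,p\}$ such that $f(x)+f(xy)+f(y)$ is the same constant for every edge $xy$; $G$ is super edge-magic if it has such a labeling. The wheel $W_n = C_n + K_1$ has vertex set $\{c, x_1,\ldots,x_n\}$ and edges $cx_i$ ($1\le i\le n$, called spokes) and $x_ix_{i+1}$ ($1\le i\le n-1$) together with $x_nx_1$ (called rims). Thus $H_n$ has vertex set $\{c,x_1,\ldots,x_n\}$ and edge set $\{cx_i: 2\le i\le n\}\cup\{x_ix_{i+1}:1\le i\le n-1\}\cup\{x_nx_1\}$. -}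

module Defs where

open import Data.Nat using (ℕ; zero; suc; _+_; _<_)
open import Data.Nat.DivMod using (_%_; m%n<n)
open import Data.Fin using (Fin; zero; suc; toℕ; fromℕ; fromℕ<; inject₁)
open import Data.List using (List; []; _++_; map; length)
open import Data.List.Base using (allFin)
open import Data.Product using (Σ; _×_; _,_; proj₁; proj₂)
open import Data.Sum using (_⊎_; inj₁; inj₂)
open import Function.Bundles using (_⤖_; Bijection)
open import Relation.Binary.PropositionalEquality using (_≡_)

record Graph : Set where
  field
    p     : ℕ
    edges : List (Fin p × Fin p)

open Graph public

q : Graph → ℕ
q G = length (edges G)

endpoints : (G : Graph) → Fin (q G) → Fin (p G) × Fin (p G)
endpoints G e = Data.List.lookup (edges G) e

-- A super edge-magic labeling: a bijection f from V ⊎ E onto the labels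
-- {1,…,p+q} (label of an element z is toℕ (f z) + 1), with the vertices
-- receiving exactly the labels {1,…,p} (by bijectivity and counting it
-- suffices that every vertex label is ≤ p), and a constant k with
-- f(x) + f(xy) + f(y) = k for every edge xy.
IsSuperEdgeMagicLabeling : (G : Graph) → (Fin (p G) ⊎ Fin (q G)) ⤖ Fin (p G + q G) → Set
IsSuperEdgeMagicLabeling G f =
  ((v : Fin (p G)) → toℕ (lab (inj₁ v)) < p G) ×
  Σ ℕ (λ k → (e : Fin (q G)) →
     suc (toℕ (lab (inj₁ (proj₁ (endpoints G e)))))
       + suc (toℕ (lab (inj₂ e)))
       + suc (toℕ (lab (inj₁ (proj₂ (endpoints G e))))) ≡ k)
  where lab = Bijection.to f

SuperEdgeMagic : Graph → Set
SuperEdgeMagic G = Σ ((Fin (p G) ⊎ Fin (q G)) ⤖ Fin (p G + q G)) (IsSuperEdgeMagicLabeling G)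

-- The graph H_n: the wheel W_n with the spoke c x₁ deleted.
-- Vertices: Fin (suc n); x_{i+1} is  inject₁ i  for i : Fin n, and the
-- centre c is  fromℕ n.
-- Edges: rims x_i x_{i+1} (1 ≤ i ≤ n-1) and x_n x_1, i.e. for i : Fin n the
-- edge between inject₁ i and inject₁ ((i+1) mod n); and the spokes c x_i for
-- 2 ≤ i ≤ n.
rimNext : (n : ℕ) → Fin n → Fin n
rimNext (suc m) i = fromℕ< (m%n<n (suc (toℕ i)) (suc m))

rims : (n : ℕ) → List (Fin (suc n) × Fin (suc n))
rims n = map (λ i → (inject₁ i , inject₁ (rimNext n i))) (allFin n)

spokesH : (n : ℕ) → List (Fin (suc n) × Fin (suc n))
spokesH zero    = []
spokesH (suc m) = map (λ j → (fromℕ (suc m) , inject₁ (suc j))) (allFin m)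

H : ℕ → Graph
H n = record { p = suc n ; edges = rims n ++ spokesH n }

module Submission where

-- Shift the vertex labels down to 0, …, n.  The magic constant then forces the end-label sums of
-- the 2n − 1 edges of H n to be exactly 1, …, 2n − 1, and replacing every label a by n − a
-- preserves this.  Rim vertices have at most two rim neighbours and, for n ≥ 4, span no
-- triangle, so realising the sums 1, 2, 3 needs the centre to carry a label ≤ 3; applied to
-- n − a this gives n ≤ 6.  Tracing which label pairs realise the remaining sums rules out
-- n = 5 (centre label 2, up to a ↦ 5 − a) and n = 6 (centre label 3).  For n = 3, 4 explicit
-- labelings are checked by computation.

open import Data.Bool using (T)
open import Data.Empty using (⊥; ⊥-elim)
open import Data.Fin using (Fin; suc; toℕ; fromℕ; fromℕ<; inject₁; join; splitAt; #_)
open import Data.Fin.Properties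
  using (toℕ-fromℕ<; toℕ-injective; fromℕ≢inject₁; inject₁-injective; toℕ<n;
         join-splitAt; splitAt-join; all?)
  renaming (_≟_ to _≟ᶠ_)
open import Data.List using (List; []; _∷_; _++_; length)
open import Data.List.Membership.Propositional.Properties using (∈-lookup; ∈-++⁻; ∈-map⁻)
open import Data.List.Properties using (length-++; length-map; length-tabulate)
open import Data.List.Relation.Unary.All using ([]; _∷_)
open import Data.List.Relation.Unary.AllPairs using (AllPairs; []; _∷_; allPairs?)
open import Data.Nat using (ℕ; suc; _+_; _∸_; _≤_; _<_; z≤n; s≤s; _≤ᵇ_; _<ᵇ_)
open import Data.Nat.DivMod using (_%_; n%n≡0; m<n⇒m%n≡m)
open import Data.Nat.Properties
open import Algebra.Properties.CommutativeSemigroup +-commutativeSemigroup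
  using () renaming (interchange to +-interchange)
open import Data.Nat.Tactic.RingSolver using (solve-∀)
open import Data.Product using (Σ-syntax; _×_; _,_; proj₁; proj₂)
open import Data.Sum using (_⊎_; inj₁; inj₂; swap)
open import Data.Vec using (Vec; lookup; []; _∷_)
open import Function.Base using (_∘_)
open import Function.Bundles using (Bijection; _⤖_; mk↔ₛ′; _⇔_; mk⇔)
open import Function.Properties.Inverse using (↔⇒⤖)
open import Relation.Binary.Definitions using (tri<; tri≈; tri>)
open import Relation.Binary.PropositionalEquality
open import Relation.Nullary using (¬_; yes; no)
open import Relation.Nullary.Decidable using (True; toWitness; ¬?)

open import Defs

data RimStep (n : ℕ) : ℕ → ℕ → Set where
  step : ∀ {t} → suc t < n → RimStep n t (suc t)
  wrap : ∀ {t} → suc t ≡ n → RimStep n t 0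

RimStep-suc-mod : ∀ {m} t → t < suc m → RimStep (suc m) t (suc t % suc m)
RimStep-suc-mod {m} t t<n with suc t <? suc m
... | yes t+1<n = subst (RimStep _ t) (sym (m<n⇒m%n≡m t+1<n)) (step t+1<n)
... | no t+1≮n  = subst (RimStep _ t) (sym (trans (cong (_% suc m) t+1≡n) (n%n≡0 (suc m)))) (wrap t+1≡n)
  where
  t+1≡n : suc t ≡ suc m
  t+1≡n = ≤-antisym t<n (≮⇒≥ t+1≮n)

rimNext-step : ∀ n (i : Fin n) → RimStep n (toℕ i) (toℕ (rimNext n i))
rimNext-step (suc m) i = subst (RimStep _ _) (sym (toℕ-fromℕ< _)) (RimStep-suc-mod (toℕ i) (toℕ<n i))

RimStep-injective : ∀ {n a b c} → RimStep n a c → RimStep n b c → a ≡ b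
RimStep-injective (step _) (step _) = refl
RimStep-injective (wrap a+1≡n) (wrap b+1≡n) = suc-injective (trans a+1≡n (sym b+1≡n))

RimStep-irreflexive : ∀ {n t} → 2 ≤ n → ¬ RimStep n t t
RimStep-irreflexive (s≤s (s≤s _)) (wrap ())

RimStep-no-3-cycle : ∀ {n a b c} → 4 ≤ n →
                     RimStep n a b → RimStep n b c → RimStep n c a → ⊥
RimStep-no-3-cycle (s≤s (s≤s (s≤s (s≤s _)))) (step _) (step _) (wrap ())
RimStep-no-3-cycle (s≤s (s≤s (s≤s (s≤s _)))) (step _) (wrap ()) (step _)
RimStep-no-3-cycle (s≤s (s≤s (s≤s (s≤s _)))) (step _) (wrap _) (wrap ())
RimStep-no-3-cycle (s≤s (s≤s (s≤s (s≤s _)))) (wrap ()) (step _) (step _)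
RimStep-no-3-cycle (s≤s (s≤s (s≤s (s≤s _)))) (wrap _) (step _) (wrap ())
RimStep-no-3-cycle (s≤s (s≤s (s≤s (s≤s _)))) (wrap _) (wrap ()) _

rimNext-injective : ∀ n (i j : Fin n) → rimNext n i ≡ rimNext n j → i ≡ j
rimNext-injective n i j eq = toℕ-injective (RimStep-injective (rimNext-step n i)
  (subst (RimStep n (toℕ j)) (cong toℕ (sym eq)) (rimNext-step n j)))

V : ℕ → Set
V n = Fin (suc n)

centre : ∀ n → V n
centre = fromℕ

x : ∀ {n} → Fin n → V n
x = inject₁

centre≢x : ∀ {n} {i : Fin n} → centre n ≢ x i
centre≢x = fromℕ≢inject₁

RimArc : ∀ n → V n → V n → Set
RimArc n u v = Σ[ i ∈ Fin n ] u ≡ x i × v ≡ x (rimNext n i)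

-- The spoke c x₁ is the one deleted; x₁ is x i with toℕ i ≡ 0.
data Arc (n : ℕ) (u v : V n) : Set where
  rim   : RimArc n u v → Arc n u v
  spoke : u ≡ centre n → (i : Fin n) → toℕ i ≢ 0 → v ≡ x i → Arc n u v

Adjacent : ∀ n → V n → V n → Set
Adjacent n u v = Arc n u v ⊎ Arc n v u

edge-arc : ∀ n (e : Fin (q (H n))) →
           Arc n (proj₁ (endpoints (H n) e)) (proj₂ (endpoints (H n) e))
edge-arc n e with ∈-++⁻ (rims n) (∈-lookup {xs = rims n ++ spokesH n} e)
... | inj₁ e∈rims with ∈-map⁻ _ e∈rims
...   | i , _ , e≡ = rim (i , cong proj₁ e≡ , cong proj₂ e≡)
edge-arc (suc m) e | inj₂ e∈spokes with ∈-map⁻ _ e∈spokes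
...   | j , _ , e≡ = spoke (cong proj₁ e≡) (suc j) (λ ()) (cong proj₂ e≡)

rimArcs : ∀ {n u v} → u ≢ centre n → v ≢ centre n →
          Adjacent n u v → RimArc n u v ⊎ RimArc n v u
rimArcs u≢c v≢c (inj₁ (rim a))           = inj₁ a
rimArcs u≢c v≢c (inj₁ (spoke u≡c _ _ _)) = ⊥-elim (u≢c u≡c)
rimArcs u≢c v≢c (inj₂ (rim a))           = inj₂ a
rimArcs u≢c v≢c (inj₂ (spoke v≡c _ _ _)) = ⊥-elim (v≢c v≡c)

Arc-irreflexive : ∀ {n u} → 2 ≤ n → ¬ Arc n u u
Arc-irreflexive {n} 2≤n (rim (i , refl , u≡next)) =
  RimStep-irreflexive 2≤n
    (subst (RimStep n (toℕ i)) (cong toℕ (sym (inject₁-injective u≡next))) (rimNext-step n i))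
Arc-irreflexive 2≤n (spoke refl i _ c≡x) = centre≢x c≡x

Adjacent-irreflexive : ∀ {n u v} → 2 ≤ n → Adjacent n u v → u ≢ v
Adjacent-irreflexive 2≤n (inj₁ a) refl = Arc-irreflexive 2≤n a
Adjacent-irreflexive 2≤n (inj₂ a) refl = Arc-irreflexive 2≤n a

centre-x₁-nonadjacent : ∀ {n} (i : Fin n) → toℕ i ≡ 0 → ¬ Adjacent n (centre n) (x i)
centre-x₁-nonadjacent i i≡0 (inj₁ (rim (_ , c≡x , _)))   = centre≢x c≡x
centre-x₁-nonadjacent i i≡0 (inj₁ (spoke _ j j≢0 xi≡xj)) =
  j≢0 (trans (cong toℕ (sym (inject₁-injective xi≡xj))) i≡0)
centre-x₁-nonadjacent i i≡0 (inj₂ (rim (_ , _ , c≡x)))   = centre≢x c≡x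
centre-x₁-nonadjacent i i≡0 (inj₂ (spoke xi≡c _ _ _))   = centre≢x (sym xi≡c)

RimArc-out-unique : ∀ {n u a b} → RimArc n u a → RimArc n u b → a ≡ b
RimArc-out-unique (i , u≡xi , a≡) (j , u≡xj , b≡)
  with inject₁-injective (trans (sym u≡xi) u≡xj)
... | refl = trans a≡ (sym b≡)

RimArc-in-unique : ∀ {n u a b} → RimArc n a u → RimArc n b u → a ≡ b
RimArc-in-unique {n} (i , a≡ , u≡) (j , b≡ , u≡′)
  with rimNext-injective n i j (inject₁-injective (trans (sym u≡) u≡′))
... | refl = trans a≡ (sym b≡)

-- Each rim vertex has one outgoing and one incoming rim arc, hence at most two rim neighbours.
rim-degree≤2 : ∀ {n u a b d} → u ≢ centre n → a ≢ centre n → b ≢ centre n → d ≢ centre n →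
               a ≢ b → a ≢ d → b ≢ d → Adjacent n u a → Adjacent n u b → Adjacent n u d → ⊥
rim-degree≤2 u≢c a≢c b≢c d≢c a≢b a≢d b≢d ua ub ud
  with rimArcs u≢c a≢c ua | rimArcs u≢c b≢c ub | rimArcs u≢c d≢c ud
... | inj₁ p | inj₁ q | _      = a≢b (RimArc-out-unique p q)
... | inj₁ p | _      | inj₁ r = a≢d (RimArc-out-unique p r)
... | _      | inj₁ q | inj₁ r = b≢d (RimArc-out-unique q r)
... | inj₂ p | inj₂ q | _      = a≢b (RimArc-in-unique p q)
... | inj₂ p | _      | inj₂ r = a≢d (RimArc-in-unique p r)
... | _      | inj₂ q | inj₂ r = b≢d (RimArc-in-unique q r)

RimArc-no-3-cycle : ∀ {n a b d} → 4 ≤ n → RimArc n a b → RimArc n b d → RimArc n d a → ⊥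
RimArc-no-3-cycle {n} 4≤n (i , a≡ , b≡) (j , b≡′ , d≡) (k , d≡′ , a≡′)
  with inject₁-injective (trans (sym b≡) b≡′) | inject₁-injective (trans (sym d≡) d≡′)
... | refl | refl = RimStep-no-3-cycle 4≤n (rimNext-step n i) (rimNext-step n _)
  (subst (RimStep n _) (cong toℕ (inject₁-injective (trans (sym a≡′) a≡))) (rimNext-step n _))

rim-triangle-free : ∀ {n u v w} → 4 ≤ n → u ≢ centre n → v ≢ centre n → w ≢ centre n →
                    Adjacent n u v → Adjacent n v w → Adjacent n u w → ⊥
rim-triangle-free {n} {u} {v} {w} 4≤n u≢c v≢c w≢c uv vw uw =
  triangle (rimArcs u≢c v≢c uv) (rimArcs v≢c w≢c vw) (rimArcs u≢c w≢c uw)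
  where
  2≤n : 2 ≤ n
  2≤n = ≤-trans (s≤s (s≤s z≤n)) 4≤n
  triangle : RimArc n u v ⊎ RimArc n v u → RimArc n v w ⊎ RimArc n w v →
             RimArc n u w ⊎ RimArc n w u → ⊥
  triangle (inj₁ p) _        (inj₁ r) = Adjacent-irreflexive 2≤n vw (RimArc-out-unique p r)
  triangle (inj₂ p) _        (inj₂ r) = Adjacent-irreflexive 2≤n vw (RimArc-in-unique p r)
  triangle (inj₁ p) (inj₂ q) (inj₂ r) = Adjacent-irreflexive 2≤n uv (RimArc-out-unique r q)
  triangle (inj₂ p) (inj₁ q) (inj₁ r) = Adjacent-irreflexive 2≤n uv (sym (RimArc-in-unique q r))
  triangle (inj₁ p) (inj₁ q) (inj₂ r) = RimArc-no-3-cycle 4≤n p q r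
  triangle (inj₂ p) (inj₂ q) (inj₁ r) = RimArc-no-3-cycle 4≤n r q p

H-edge-count : ∀ m → suc (q (H (suc m))) ≡ suc m + suc m
H-edge-count m = begin
  suc (length (rims (suc m) ++ spokesH (suc m)))          ≡⟨ cong suc (length-++ (rims (suc m))) ⟩
  suc (length (rims (suc m)) + length (spokesH (suc m)))  ≡⟨ cong suc (cong₂ _+_ rims-length spokes-length) ⟩
  suc (suc m + m)                                         ≡⟨ sym (+-suc (suc m) m) ⟩
  suc m + suc m                                           ∎
  where
  open ≡-Reasoning
  rims-length : length (rims (suc m)) ≡ suc m
  rims-length = trans (length-map _ (Data.List.allFin (suc m))) (length-tabulate (λ i → i))
  spokes-length : length (spokesH (suc m)) ≡ m
  spokes-length = trans (length-map _ (Data.List.allFin m)) (length-tabulate (λ i → i))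

SumOnEdge : ∀ n → (V n → ℕ) → ℕ → Set
SumOnEdge n label s = Σ[ u ∈ V n ] Σ[ v ∈ V n ] Adjacent n u v × label u + label v ≡ s

record ConsecutiveLabeling (n : ℕ) : Set where
  field
    label           : V n → ℕ
    label≤n         : ∀ v → label v ≤ n
    label-injective : ∀ {u v} → label u ≡ label v → u ≡ v
    sum-attained    : ∀ s → 1 ≤ s → s < n + n → SumOnEdge n label s

complement-sum : ∀ n a b s → a ≤ n → b ≤ n → s ≤ n + n →
                 a + b ≡ n + n ∸ s → (n ∸ a) + (n ∸ b) ≡ s
complement-sum n a b s a≤n b≤n s≤2n a+b≡ = +-cancelʳ-≡ (a + b) _ _ (begin
  (n ∸ a) + (n ∸ b) + (a + b)    ≡⟨ +-interchange (n ∸ a) (n ∸ b) a b ⟩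
  ((n ∸ a) + a) + ((n ∸ b) + b)  ≡⟨ cong₂ _+_ (m∸n+n≡m a≤n) (m∸n+n≡m b≤n) ⟩
  n + n                          ≡⟨ sym (m+[n∸m]≡n s≤2n) ⟩
  s + (n + n ∸ s)                ≡⟨ cong (s +_) (sym a+b≡) ⟩
  s + (a + b)                    ∎)
  where open ≡-Reasoning

complement : ∀ {n} → ConsecutiveLabeling n → ConsecutiveLabeling n
complement {n} C = record
  { label           = λ v → n ∸ label v
  ; label≤n         = λ v → m∸n≤m n (label v)
  ; label-injective = λ e → label-injective (∸-cancelˡ-≡ (label≤n _) (label≤n _) e)
  ; sum-attained    = λ s 1≤s s<2n →
      mirror s (<⇒≤ s<2n) (sum-attained (n + n ∸ s) (m<n⇒0<n∸m s<2n) (∸-monoʳ-< 1≤s (<⇒≤ s<2n)))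
  }
  where
  open ConsecutiveLabeling C
  mirror : ∀ s → s ≤ n + n → SumOnEdge n label (n + n ∸ s) → SumOnEdge n (λ v → n ∸ label v) s
  mirror s s≤2n (u , v , uv , sum≡) =
    u , v , uv , complement-sum n _ _ s (label≤n u) (label≤n v) s≤2n sum≡

distinct-sum-bounds : ∀ {n a b} → a ≤ n → b ≤ n → a ≢ b → 1 ≤ a + b × a + b < n + n
distinct-sum-bounds {n} {a} {b} a≤n b≤n a≢b = positive , below
  where
  positive : 1 ≤ a + b
  positive = n≢0⇒n>0 λ a+b≡0 → a≢b (trans (m+n≡0⇒m≡0 a a+b≡0) (sym (m+n≡0⇒n≡0 a a+b≡0)))
  below : a + b < n + n
  below with a ≟ n
  ... | yes refl = +-mono-≤-< ≤-refl (≤∧≢⇒< b≤n (a≢b ∘ sym))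
  ... | no a≢n   = +-mono-<-≤ (≤∧≢⇒< a≤n a≢n) b≤n

edge-sum-cancel : ∀ n Q s σ → s ≤ suc Q → σ + (n + (suc Q ∸ s)) + 3 ≡ n + Q + 4 → σ ≡ s
edge-sum-cancel n Q s σ s≤Q+1 magic = +-cancelʳ-≡ (r + (n + 3)) σ s (begin
  σ + (r + (n + 3))      ≡⟨ shuffle σ r n ⟩
  σ + (n + r) + 3        ≡⟨ magic ⟩
  n + Q + 4              ≡⟨ shuffle′ n Q ⟩
  suc Q + (n + 3)        ≡⟨ cong (_+ (n + 3)) (sym (m+[n∸m]≡n s≤Q+1)) ⟩
  s + r + (n + 3)        ≡⟨ +-assoc s r (n + 3) ⟩
  s + (r + (n + 3))      ∎)
  where
  open ≡-Reasoning
  r : ℕ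
  r = suc Q ∸ s
  shuffle : ∀ a b c → a + (b + (c + 3)) ≡ a + (c + b) + 3
  shuffle = solve-∀
  shuffle′ : ∀ a b → a + b + 4 ≡ suc b + (a + 3)
  shuffle′ = solve-∀

module SuperEdgeMagicLabels {m : ℕ} (2≤n : 2 ≤ suc m) (sem : SuperEdgeMagic (H (suc m))) where
  open ≤-Reasoning

  private
    n Q k : ℕ
    n = suc m
    Q = q (H n)
    k = proj₁ (proj₂ (proj₂ sem))
    f : (Fin (p (H n)) ⊎ Fin Q) ⤖ Fin (p (H n) + Q)
    f = proj₁ sem

  label : V n → ℕ
  label v = toℕ (Bijection.to f (inj₁ v))

  edge-label : Fin Q → ℕ
  edge-label e = toℕ (Bijection.to f (inj₂ e))

  end-sum : Fin Q → ℕ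
  end-sum e = label (proj₁ (endpoints (H n) e)) + label (proj₂ (endpoints (H n) e))

  label≤n : ∀ v → label v ≤ n
  label≤n v = ≤-pred (proj₁ (proj₂ sem) v)

  label-injective : ∀ {u v} → label u ≡ label v → u ≡ v
  label-injective eq with Bijection.injective f (toℕ-injective eq)
  ... | refl = refl

  magic : ∀ e → end-sum e + edge-label e + 3 ≡ k
  magic e = trans (shuffle (label _) (edge-label e) (label _)) (proj₂ (proj₂ (proj₂ sem)) e)
    where
    shuffle : ∀ a b c → a + c + b + 3 ≡ suc a + suc b + suc c
    shuffle = solve-∀

  end-sum-bounds : ∀ e → 1 ≤ end-sum e × end-sum e < n + n
  end-sum-bounds e = distinct-sum-bounds (label≤n _) (label≤n _)
    (λ eq → Adjacent-irreflexive 2≤n (inj₁ (edge-arc n e)) (label-injective eq))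

  1≤end-sum : ∀ e → 1 ≤ end-sum e
  1≤end-sum e = proj₁ (end-sum-bounds e)

  end-sum<2n : ∀ e → end-sum e < n + n
  end-sum<2n e = proj₂ (end-sum-bounds e)

  edge-labelled : ∀ t → n < t → (t<p+q : t < suc n + Q) → Σ[ e ∈ Fin Q ] edge-label e ≡ t
  edge-labelled t n<t t<p+q with Bijection.surjective f (fromℕ< t<p+q)
  ... | inj₁ v , to≡ = ⊥-elim (<⇒≱ (s≤s (label≤n v)) (subst (n <_) (sym label≡t) n<t))
    where
    label≡t : label v ≡ t
    label≡t = trans (cong toℕ (to≡ refl)) (toℕ-fromℕ< t<p+q)
  ... | inj₂ e , to≡ = e , trans (cong toℕ (to≡ refl)) (toℕ-fromℕ< t<p+q)

  <2n⇒≤Q : ∀ {s} → s < n + n → s ≤ Q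
  <2n⇒≤Q {s} s<2n = ≤-pred (subst (s <_) (sym (H-edge-count m)) s<2n)

  0<Q : 0 < Q
  0<Q = <2n⇒≤Q (+-mono-≤ (s≤s z≤n) (s≤s z≤n))

  -- The edges labelled n + 1 and n + Q have end sums at most 2n − 1 = Q and at least 1.
  magic-constant : k ≡ n + Q + 4
  magic-constant = ≤-antisym
    (let e₀ , label₀ = edge-labelled (suc n) ≤-refl (m<m+n (suc n) 0<Q) in begin
      k                              ≡⟨ sym (magic e₀) ⟩
      end-sum e₀ + edge-label e₀ + 3 ≡⟨ cong (λ t → end-sum e₀ + t + 3) label₀ ⟩
      end-sum e₀ + suc n + 3         ≤⟨ +-monoˡ-≤ 3 (+-monoˡ-≤ (suc n) (<2n⇒≤Q (end-sum<2n e₀))) ⟩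
      Q + suc n + 3                  ≡⟨ shuffle n Q ⟩
      n + Q + 4                      ∎)
    (let e₁ , label₁ = edge-labelled (n + Q) (m<m+n n 0<Q) ≤-refl in begin
      n + Q + 4                      ≡⟨ +-suc (n + Q) 3 ⟩
      1 + (n + Q) + 3                ≤⟨ +-monoˡ-≤ 3 (+-monoˡ-≤ (n + Q) (1≤end-sum e₁)) ⟩
      end-sum e₁ + (n + Q) + 3       ≡⟨ cong (λ t → end-sum e₁ + t + 3) (sym label₁) ⟩
      end-sum e₁ + edge-label e₁ + 3 ≡⟨ magic e₁ ⟩
      k                              ∎)
    where
    shuffle : ∀ a b → b + suc a + 3 ≡ a + b + 4
    shuffle = solve-∀

  sum-attained : ∀ s → 1 ≤ s → s < n + n → SumOnEdge n label s
  sum-attained s 1≤s s<2n =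
    let e , label≡ = edge-labelled (n + (suc Q ∸ s)) (m<m+n n (m<n⇒0<n∸m (s≤s (<2n⇒≤Q s<2n))))
                                                     (s≤s (+-monoʳ-≤ n (∸-monoʳ-≤ (suc Q) 1≤s)))
    in _ , _ , inj₁ (edge-arc n e) , edge-sum-cancel n Q s (end-sum e) (m≤n⇒m≤1+n (<2n⇒≤Q s<2n))
         (trans (cong (λ t → end-sum e + t + 3) (sym label≡)) (trans (magic e) magic-constant))

  consecutive : ConsecutiveLabeling n
  consecutive = record
    { label           = label
    ; label≤n         = label≤n
    ; label-injective = label-injective
    ; sum-attained    = sum-attained
    }

superEdgeMagic⇒consecutive : ∀ {n} → 2 ≤ n → SuperEdgeMagic (H n) → ConsecutiveLabeling n
superEdgeMagic⇒consecutive {suc m} 2≤n sem = SuperEdgeMagicLabels.consecutive 2≤n sem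

m+m<2+n+n⇒m≤n : ∀ {m n} → m + m < 2 + (n + n) → m ≤ n
m+m<2+n+n⇒m≤n {m} {n} m+m< with m ≤? n
... | yes m≤n = m≤n
... | no m≰n  =
  ⊥-elim (<⇒≱ m+m< (subst (_≤ m + m) (cong suc (+-suc n n)) (+-mono-≤ (≰⇒> m≰n) (≰⇒> m≰n))))

Distinct : List ℕ → Set
Distinct = AllPairs _≢_

distinct : ∀ {xs} {_ : True (allPairs? (λ a b → ¬? (a ≟ b)) xs)} → Distinct xs
distinct {xs} {p} = toWitness {a? = allPairs? (λ a b → ¬? (a ≟ b)) xs} p

module LabelGraph {n : ℕ} (C : ConsecutiveLabeling n) (4≤n : 4 ≤ n) where
  open ConsecutiveLabeling C

  2≤n : 2 ≤ n
  2≤n = ≤-trans (s≤s (s≤s z≤n)) 4≤n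

  infix 4 _~_
  _~_ : ℕ → ℕ → Set
  a ~ b = Σ[ u ∈ V n ] Σ[ v ∈ V n ] Adjacent n u v × label u ≡ a × label v ≡ b

  ~-sym : ∀ {a b} → a ~ b → b ~ a
  ~-sym (u , v , uv , refl , refl) = v , u , swap uv , refl , refl

  off-centre : ∀ {k v} → label (centre n) ≡ k → k ≢ label v → v ≢ centre n
  off-centre c≡k k≢v refl = k≢v (sym c≡k)

  no-three-rim-neighbours : ∀ {k a b₁ b₂ b₃} → label (centre n) ≡ k →
                            Distinct (k ∷ a ∷ b₁ ∷ b₂ ∷ b₃ ∷ []) → a ~ b₁ → a ~ b₂ → a ~ b₃ → ⊥
  no-three-rim-neighbours c≡k
    ((k≢a ∷ k≢b₁ ∷ k≢b₂ ∷ k≢b₃ ∷ []) ∷ _ ∷ (b₁≢b₂ ∷ b₁≢b₃ ∷ []) ∷ (b₂≢b₃ ∷ []) ∷ [] ∷ [])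
    (u , v₁ , uv₁ , refl , refl) (u′ , v₂ , uv₂ , u′≡u , refl) (u″ , v₃ , uv₃ , u″≡u , refl)
    with label-injective u′≡u | label-injective u″≡u
  ... | refl | refl =
    rim-degree≤2 (off-centre c≡k k≢a) (off-centre c≡k k≢b₁) (off-centre c≡k k≢b₂) (off-centre c≡k k≢b₃)
      (b₁≢b₂ ∘ cong label) (b₁≢b₃ ∘ cong label) (b₂≢b₃ ∘ cong label) uv₁ uv₂ uv₃

  no-rim-triangle : ∀ {k a b d} → label (centre n) ≡ k →
                    Distinct (k ∷ a ∷ b ∷ d ∷ []) → a ~ b → b ~ d → a ~ d → ⊥
  no-rim-triangle c≡k ((k≢a ∷ k≢b ∷ k≢d ∷ []) ∷ _)
    (u , v , uv , refl , refl) (v′ , w , vw , v′≡v , refl) (u′ , w′ , uw , u′≡u , w′≡w)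
    with label-injective v′≡v | label-injective u′≡u | label-injective w′≡w
  ... | refl | refl | refl =
    rim-triangle-free 4≤n (off-centre c≡k k≢a) (off-centre c≡k k≢b) (off-centre c≡k k≢d) uv vw uw

  centre-nonneighbour : ∀ {k} → label (centre n) ≡ k → Σ[ ℓ ∈ ℕ ] ℓ ≤ n × ℓ ≢ k × ¬ (k ~ ℓ)
  centre-nonneighbour c≡k = label x₁ , label≤n x₁ , x₁≢k , ¬k~x₁
    where
    0<n : 0 < n
    0<n = ≤-trans (s≤s z≤n) 4≤n
    x₁ : V n
    x₁ = x (fromℕ< 0<n)
    x₁≢k : label x₁ ≢ _
    x₁≢k x₁≡k = centre≢x (label-injective (trans c≡k (sym x₁≡k)))
    ¬k~x₁ : ¬ (_ ~ label x₁)
    ¬k~x₁ (u , v , uv , u≡k , v≡x₁)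
      with label-injective (trans u≡k (sym c≡k)) | label-injective v≡x₁
    ... | refl | refl = centre-x₁-nonadjacent (fromℕ< 0<n) (toℕ-fromℕ< 0<n) uv

  -- Both bounds are Boolean so that, for concrete s, h and n, impossible values of the smaller
  -- label a are refuted by an absurd pattern.
  Split : ℕ → ℕ → Set
  Split s h = Σ[ a ∈ ℕ ] a ~ (s ∸ a) × T (a ≤ᵇ h) × T (s ∸ a ≤ᵇ n)

  split : ∀ s h {1≤s : T (1 ≤ᵇ s)} {s<2n : T (s <ᵇ n + n)} {s≤2h+2 : T (s ≤ᵇ 2 + (h + h))} →
          Split s h
  split s h {1≤s} {s<2n} {s≤2h+2} =
    from-edge (sum-attained s (≤ᵇ⇒≤ 1 s 1≤s) (<ᵇ⇒< s (n + n) s<2n))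
    where
    ordered : ∀ {a b} → a < b → b ≤ n → a ~ b → a + b ≡ s → Split s h
    ordered {a} {b} a<b b≤n a~b refl =
      a , subst (a ~_) (sym (m+n∸m≡n a b)) a~b ,
      ≤⇒≤ᵇ (m+m<2+n+n⇒m≤n {a} {h} (<-≤-trans (+-monoʳ-< a a<b) (≤ᵇ⇒≤ _ _ s≤2h+2))) ,
      ≤⇒≤ᵇ (subst (_≤ n) (sym (m+n∸m≡n a b)) b≤n)
    from-edge : SumOnEdge n label s → Split s h
    from-edge (u , v , uv , sum≡) with <-cmp (label u) (label v)
    ... | tri< lu<lv _ _ = ordered lu<lv (label≤n v) (u , v , uv , refl , refl) sum≡
    ... | tri≈ _ lu≡lv _ = ⊥-elim (Adjacent-irreflexive 2≤n uv (label-injective lu≡lv))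
    ... | tri> _ _ lv<lu = ordered lv<lu (label≤n u) (v , u , swap uv , refl , refl)
                                   (trans (+-comm (label v) (label u)) sum≡)

  -- The sums 1, 2 and 3 come from the label pairs {0,1}, {0,2} and {0,3} or {1,2}.  If none of these
  -- labels is on the centre, then 0 has three rim neighbours or 0, 1, 2 form a rim triangle.
  centre-label≤3 : label (centre n) ≤ 3
  centre-label≤3 with label (centre n) ≤? 3
  ... | yes c≤3 = c≤3
  ... | no c≰3  = ⊥-elim (small-sums (split 1 0 {s<2n = small<2n 1}) (split 2 0 {s<2n = small<2n 2})
                                     (split 3 1 {s<2n = small<2n 3}))
    where
    small<2n : ∀ s {s≤3 : T (s ≤ᵇ 3)} → T (s <ᵇ n + n)
    small<2n s {s≤3} = <⇒<ᵇ (≤-trans (s≤s (≤ᵇ⇒≤ s 3 s≤3)) (≤-trans 4≤n (m≤m+n n n)))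
    c≢ : ∀ a {a≤3 : T (a ≤ᵇ 3)} → label (centre n) ≢ a
    c≢ a {a≤3} c≡a = c≰3 (subst (_≤ 3) (sym c≡a) (≤ᵇ⇒≤ a 3 a≤3))
    small-sums : Split 1 0 → Split 2 0 → Split 3 1 → ⊥
    small-sums (suc _ , _ , () , _) _ _
    small-sums _ (suc _ , _ , () , _) _
    small-sums _ _ (suc (suc _) , _ , () , _)
    small-sums (0 , 0~1 , _) (0 , 0~2 , _) (0 , 0~3 , _) =
      no-three-rim-neighbours refl ((c≢ 0 ∷ c≢ 1 ∷ c≢ 2 ∷ c≢ 3 ∷ []) ∷ distinct) 0~1 0~2 0~3
    small-sums (0 , 0~1 , _) (0 , 0~2 , _) (1 , 1~2 , _) =
      no-rim-triangle refl ((c≢ 0 ∷ c≢ 1 ∷ c≢ 2 ∷ []) ∷ distinct) 0~1 1~2 0~2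

module CentreLabel5 (C : ConsecutiveLabeling 5) (c≡2 : ConsecutiveLabeling.label C (centre 5) ≡ 2)
  where
  open LabelGraph C (s≤s (s≤s (s≤s (s≤s z≤n))))

  centre-universal : 2 ~ 0 → 2 ~ 1 → 2 ~ 3 → 2 ~ 4 → 2 ~ 5 → ⊥
  centre-universal 2~0 2~1 2~3 2~4 2~5 with centre-nonneighbour c≡2
  ... | 0 , _ , _ , ¬2~0 = ¬2~0 2~0
  ... | 1 , _ , _ , ¬2~1 = ¬2~1 2~1
  ... | 2 , _ , 2≢2 , _  = 2≢2 refl
  ... | 3 , _ , _ , ¬2~3 = ¬2~3 2~3
  ... | 4 , _ , _ , ¬2~4 = ¬2~4 2~4
  ... | 5 , _ , _ , ¬2~5 = ¬2~5 2~5
  ... | suc (suc (suc (suc (suc (suc _))))) , s≤s (s≤s (s≤s (s≤s (s≤s ())))) , _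

  0~1 : 0 ~ 1
  0~1 with split 1 0
  ... | 0 , 0~1 , _ = 0~1
  ... | suc _ , _ , () , _

  0~2 : 0 ~ 2
  0~2 with split 2 0
  ... | 0 , 0~2 , _ = 0~2
  ... | suc _ , _ , () , _

  4~5 : 4 ~ 5
  4~5 with split 9 4
  ... | 0 , _ , _ , ()
  ... | 1 , _ , _ , ()
  ... | 2 , _ , _ , ()
  ... | 3 , _ , _ , ()
  ... | 4 , 4~5 , _ = 4~5
  ... | suc (suc (suc (suc (suc _)))) , _ , () , _

  3~5 : 3 ~ 5
  3~5 with split 8 3
  ... | 0 , _ , _ , ()
  ... | 1 , _ , _ , ()
  ... | 2 , _ , _ , ()
  ... | 3 , 3~5 , _ = 3~5
  ... | suc (suc (suc (suc _))) , _ , () , _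

  2~5 : 2 ~ 5
  2~5 with split 7 3
  ... | 0 , _ , _ , ()
  ... | 1 , _ , _ , ()
  ... | 2 , 2~5 , _ = 2~5
  ... | 3 , 3~4 , _ = ⊥-elim (no-rim-triangle c≡2 distinct 3~4 4~5 3~5)
  ... | suc (suc (suc (suc _))) , _ , () , _

  ¬0~4 : ¬ (0 ~ 4)
  ¬0~4 0~4 with split 3 1 | split 5 2 | split 6 2
  ... | suc (suc _) , _ , () , _ | _ | _
  ... | _ | suc (suc (suc _)) , _ , () , _ | _
  ... | _ | _ | suc (suc (suc _)) , _ , () , _
  ... | _ | _ | 0 , _ , _ , ()
  ... | 0 , 0~3 , _ | _ | _ = no-three-rim-neighbours c≡2 distinct 0~1 0~4 0~3
  ... | _ | 0 , 0~5 , _ | _ = no-three-rim-neighbours c≡2 distinct 0~1 0~4 0~5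
  ... | _ | 1 , 1~4 , _ | _ = no-three-rim-neighbours c≡2 distinct 4~5 (~-sym 0~4) (~-sym 1~4)
  ... | _ | _ | 1 , 1~5 , _ = no-three-rim-neighbours c≡2 distinct (~-sym 4~5) (~-sym 3~5) (~-sym 1~5)
  ... | 1 , 1~2 , _ | 2 , 2~3 , _ | 2 , 2~4 , _ = centre-universal (~-sym 0~2) (~-sym 1~2) 2~3 2~4 2~5

  ¬1~3 : ¬ (1 ~ 3)
  ¬1~3 1~3 with split 3 1 | split 5 2 | split 6 2
  ... | suc (suc _) , _ , () , _ | _ | _
  ... | _ | suc (suc (suc _)) , _ , () , _ | _
  ... | _ | _ | suc (suc (suc _)) , _ , () , _
  ... | _ | _ | 0 , _ , _ , ()
  ... | 0 , 0~3 , _ | _ | _ = no-three-rim-neighbours c≡2 distinct 3~5 (~-sym 1~3) (~-sym 0~3)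
  ... | _ | 0 , 0~5 , _ | _ = no-three-rim-neighbours c≡2 distinct (~-sym 4~5) (~-sym 3~5) (~-sym 0~5)
  ... | _ | 1 , 1~4 , _ | _ = no-three-rim-neighbours c≡2 distinct (~-sym 0~1) 1~3 1~4
  ... | _ | _ | 1 , 1~5 , _ = no-three-rim-neighbours c≡2 distinct (~-sym 0~1) 1~3 1~5
  ... | 1 , 1~2 , _ | 2 , 2~3 , _ | 2 , 2~4 , _ = centre-universal (~-sym 0~2) (~-sym 1~2) 2~3 2~4 2~5

  impossible : ⊥
  impossible with split 4 1
  ... | 0 , 0~4 , _ = ¬0~4 0~4
  ... | 1 , 1~3 , _ = ¬1~3 1~3
  ... | suc (suc _) , _ , () , _

module CentreLabel6 (C : ConsecutiveLabeling 6) (c≡3 : ConsecutiveLabeling.label C (centre 6) ≡ 3)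
  where
  open LabelGraph C (s≤s (s≤s (s≤s (s≤s z≤n))))

  centre-universal : 3 ~ 0 → 3 ~ 1 → 3 ~ 2 → 3 ~ 4 → 3 ~ 5 → 3 ~ 6 → ⊥
  centre-universal 3~0 3~1 3~2 3~4 3~5 3~6 with centre-nonneighbour c≡3
  ... | 0 , _ , _ , ¬3~0 = ¬3~0 3~0
  ... | 1 , _ , _ , ¬3~1 = ¬3~1 3~1
  ... | 2 , _ , _ , ¬3~2 = ¬3~2 3~2
  ... | 3 , _ , 3≢3 , _  = 3≢3 refl
  ... | 4 , _ , _ , ¬3~4 = ¬3~4 3~4
  ... | 5 , _ , _ , ¬3~5 = ¬3~5 3~5
  ... | 6 , _ , _ , ¬3~6 = ¬3~6 3~6
  ... | suc (suc (suc (suc (suc (suc (suc _)))))) , s≤s (s≤s (s≤s (s≤s (s≤s (s≤s ()))))) , _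

  0~1 : 0 ~ 1
  0~1 with split 1 0
  ... | 0 , 0~1 , _ = 0~1
  ... | suc _ , _ , () , _

  0~2 : 0 ~ 2
  0~2 with split 2 0
  ... | 0 , 0~2 , _ = 0~2
  ... | suc _ , _ , () , _

  0~3 : 0 ~ 3
  0~3 with split 3 1
  ... | 0 , 0~3 , _ = 0~3
  ... | 1 , 1~2 , _ = ⊥-elim (no-rim-triangle c≡3 distinct 0~1 1~2 0~2)
  ... | suc (suc _) , _ , () , _

  5~6 : 5 ~ 6
  5~6 with split 11 5
  ... | 0 , _ , _ , ()
  ... | 1 , _ , _ , ()
  ... | 2 , _ , _ , ()
  ... | 3 , _ , _ , ()
  ... | 4 , _ , _ , ()
  ... | 5 , 5~6 , _ = 5~6
  ... | suc (suc (suc (suc (suc (suc _))))) , _ , () , _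

  4~6 : 4 ~ 6
  4~6 with split 10 4
  ... | 0 , _ , _ , ()
  ... | 1 , _ , _ , ()
  ... | 2 , _ , _ , ()
  ... | 3 , _ , _ , ()
  ... | 4 , 4~6 , _ = 4~6
  ... | suc (suc (suc (suc (suc _)))) , _ , () , _

  3~6 : 3 ~ 6
  3~6 with split 9 4
  ... | 0 , _ , _ , ()
  ... | 1 , _ , _ , ()
  ... | 2 , _ , _ , ()
  ... | 3 , 3~6 , _ = 3~6
  ... | 4 , 4~5 , _ = ⊥-elim (no-rim-triangle c≡3 distinct 4~5 5~6 4~6)
  ... | suc (suc (suc (suc (suc _)))) , _ , () , _

  1~3 : 1 ~ 3
  1~3 with split 4 1
  ... | 0 , 0~4 , _ = ⊥-elim (no-three-rim-neighbours c≡3 distinct 0~1 0~2 0~4)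
  ... | 1 , 1~3 , _ = 1~3
  ... | suc (suc _) , _ , () , _

  3~5 : 3 ~ 5
  3~5 with split 8 3
  ... | 0 , _ , _ , ()
  ... | 1 , _ , _ , ()
  ... | 2 , 2~6 , _ = ⊥-elim (no-three-rim-neighbours c≡3 distinct (~-sym 5~6) (~-sym 4~6) (~-sym 2~6))
  ... | 3 , 3~5 , _ = 3~5
  ... | suc (suc (suc (suc _))) , _ , () , _

  impossible : ⊥
  impossible with split 6 2 | split 5 2 | split 7 3
  ... | suc (suc (suc _)) , _ , () , _ | _ | _
  ... | _ | suc (suc (suc _)) , _ , () , _ | _
  ... | _ | _ | suc (suc (suc (suc _))) , _ , () , _
  ... | _ | _ | 0 , _ , _ , ()
  ... | 0 , 0~6 , _ | _ | _ = no-three-rim-neighbours c≡3 distinct 0~1 0~2 0~6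
  ... | _ | 0 , 0~5 , _ | _ = no-three-rim-neighbours c≡3 distinct 0~1 0~2 0~5
  ... | _ | _ | 1 , 1~6 , _ = no-three-rim-neighbours c≡3 distinct (~-sym 5~6) (~-sym 4~6) (~-sym 1~6)
  ... | 1 , 1~5 , _ | 1 , 1~4 , _ | _ = no-three-rim-neighbours c≡3 distinct (~-sym 0~1) 1~5 1~4
  ... | 1 , 1~5 , _ | _ | 2 , 2~5 , _ = no-three-rim-neighbours c≡3 distinct 5~6 (~-sym 1~5) (~-sym 2~5)
  ... | 2 , 2~4 , _ | 1 , 1~4 , _ | _ = no-three-rim-neighbours c≡3 distinct 4~6 (~-sym 2~4) (~-sym 1~4)
  ... | 2 , 2~4 , _ | _ | 2 , 2~5 , _ = no-three-rim-neighbours c≡3 distinct (~-sym 0~2) 2~4 2~5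
  ... | _ | 2 , 2~3 , _ | 3 , 3~4 , _ = centre-universal (~-sym 0~3) (~-sym 1~3) (~-sym 2~3) 3~4 3~5 3~6

centre-label-contradiction : ∀ {m γ} (C : ConsecutiveLabeling (5 + m)) →
                             ConsecutiveLabeling.label C (centre _) ≡ γ → γ ≤ 3 → 5 + m ∸ γ ≤ 3 → ⊥
centre-label-contradiction {γ = suc (suc (suc (suc _)))} _ _ (s≤s (s≤s (s≤s ()))) _
centre-label-contradiction {γ = 0} _ _ _ (s≤s (s≤s (s≤s ())))
centre-label-contradiction {γ = 1} _ _ _ (s≤s (s≤s (s≤s ())))
centre-label-contradiction {0} {2} C c≡2 _ _ = CentreLabel5.impossible C c≡2
centre-label-contradiction {0} {3} C c≡3 _ _ = CentreLabel5.impossible (complement C) (cong (5 ∸_) c≡3)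
centre-label-contradiction {1} {3} C c≡3 _ _ = CentreLabel6.impossible C c≡3
centre-label-contradiction {suc _} {2} _ _ _ (s≤s (s≤s (s≤s ())))
centre-label-contradiction {suc (suc _)} {3} _ _ _ (s≤s (s≤s (s≤s ())))

no-consecutive-labeling : ∀ {n} → 5 ≤ n → ¬ ConsecutiveLabeling n
no-consecutive-labeling 5≤n@(s≤s (s≤s (s≤s (s≤s (s≤s _))))) C =
  centre-label-contradiction C refl (centre-label≤3 C 4≤n) (centre-label≤3 (complement C) 4≤n)
  where
  open LabelGraph using (centre-label≤3)
  4≤n : 4 ≤ _
  4≤n = ≤-trans (n≤1+n 4) 5≤n

-- ℓ lists the labels, shifted down by one, of the vertices and then of the edges of G, and ℓ⁻¹
-- is its inverse.  For H n the order is x₁, …, xₙ, c, then x₁x₂, …, xₙx₁, then cx₂, …, cxₙ.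
superEdgeMagic-from-table : (G : Graph) (ℓ ℓ⁻¹ : Vec (Fin (p G + q G)) (p G + q G)) (k : ℕ) →
  let lab = λ z → lookup ℓ (join (p G) (q G) z) in
  {_ : True (all? λ i → lookup ℓ (lookup ℓ⁻¹ i) ≟ᶠ i)} →
  {_ : True (all? λ i → lookup ℓ⁻¹ (lookup ℓ i) ≟ᶠ i)} →
  {_ : True (all? λ v → toℕ (lab (inj₁ v)) <? p G)} →
  {_ : True (all? λ e → suc (toℕ (lab (inj₁ (proj₁ (endpoints G e))))) + suc (toℕ (lab (inj₂ e)))
                          + suc (toℕ (lab (inj₁ (proj₂ (endpoints G e))))) ≟ k)} →
  SuperEdgeMagic G
superEdgeMagic-from-table G ℓ ℓ⁻¹ k {inverseˡ} {inverseʳ} {vertex-labels} {magic} =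
  ↔⇒⤖ (mk↔ₛ′ lab unlab lab∘unlab unlab∘lab) ,
  toWitness vertex-labels , k , toWitness magic
  where
  lab : Fin (p G) ⊎ Fin (q G) → Fin (p G + q G)
  lab z = lookup ℓ (join (p G) (q G) z)
  unlab : Fin (p G + q G) → Fin (p G) ⊎ Fin (q G)
  unlab i = splitAt (p G) (lookup ℓ⁻¹ i)
  lab∘unlab : ∀ i → lab (unlab i) ≡ i
  lab∘unlab i =
    trans (cong (lookup ℓ) (join-splitAt (p G) (q G) (lookup ℓ⁻¹ i))) (toWitness inverseˡ i)
  unlab∘lab : ∀ z → unlab (lab z) ≡ z
  unlab∘lab z =
    trans (cong (splitAt (p G)) (toWitness inverseʳ (join (p G) (q G) z))) (splitAt-join (p G) (q G) z)

H₃-superEdgeMagic : SuperEdgeMagic (H 3)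
H₃-superEdgeMagic = superEdgeMagic-from-table (H 3)
  (# 0 ∷ # 1 ∷ # 2 ∷ # 3 ∷ # 8 ∷ # 6 ∷ # 7 ∷ # 5 ∷ # 4 ∷ [])
  (# 0 ∷ # 1 ∷ # 2 ∷ # 3 ∷ # 8 ∷ # 7 ∷ # 5 ∷ # 6 ∷ # 4 ∷ [])
  12

H₄-superEdgeMagic : SuperEdgeMagic (H 4)
H₄-superEdgeMagic = superEdgeMagic-from-table (H 4)
  (# 2 ∷ # 0 ∷ # 1 ∷ # 4 ∷ # 3 ∷ # 10 ∷ # 11 ∷ # 7 ∷ # 6 ∷ # 9 ∷ # 8 ∷ # 5 ∷ [])
  (# 1 ∷ # 2 ∷ # 0 ∷ # 4 ∷ # 3 ∷ # 11 ∷ # 8 ∷ # 7 ∷ # 10 ∷ # 9 ∷ # 5 ∷ # 6 ∷ [])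
  15

theorem1 : (n : ℕ) → 3 ≤ n → (SuperEdgeMagic (H n) ⇔ n ≤ 4)
theorem1 1 (s≤s ())
theorem1 2 (s≤s (s≤s ()))
theorem1 3 _ = mk⇔ (λ _ → n≤1+n 3) (λ _ → H₃-superEdgeMagic)
theorem1 4 _ = mk⇔ (λ _ → ≤-refl) (λ _ → H₄-superEdgeMagic)
theorem1 n@(suc (suc (suc (suc (suc _))))) _ = mk⇔
  (λ sem → ⊥-elim (no-consecutive-labeling 5≤n (superEdgeMagic⇒consecutive 2≤n sem)))
  (λ n≤4 → ⊥-elim (<⇒≱ 5≤n n≤4))
  where
  5≤n : 5 ≤ n
  5≤n = s≤s (s≤s (s≤s (s≤s (s≤s z≤n))))
  2≤n : 2 ≤ n
  2≤n = s≤s (s≤s z≤n)
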